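{- Let $\mathbf{L}\in\{\mathbf{K_n},\mathbf{KD_n},\mathbf{KT_n}\}$; all formulas are in $\mathcal{L}^2$. (Post-interpolants.) For any formula $A(\overrightarrow{p},\overrightarrow{q})$ and propositional variables $\overrightarrow{q}$ all different from those in $\overrightarrow{p}$, there exists a formula $\mathcal{I}_{post}(A,\overrightarrow{q})$ such that: (1) $A(\overrightarrow{p},\overrightarrow{q})\Rightarrow\mathcal{I}_{post}(A,\overrightarrow{q})$ is derivable in $\mathsf{G}(\mathbf{L}^2)$; (2) for any formula $B(\overrightarrow{q},\overrightarrow{r})$, where the variables $\overrightarrow{r}$ differ from those in $\overrightarrow{q}$ and in $\overrightarrow{p}$, if $A(\overrightarrow{p},\overrightarrow{q})\Rightarrow B(\overrightarrow{q},\overrightarrow{r})$ is derivable in $\mathsf{G}(\mathbf{L}^2)$, then $\mathcal{I}_{post}(A,\overrightarrow{q})\Rightarrow B(\overrightarrow{q},\overrightarrow{r})$ is derivable in $\mathsf{G}(\mathbf{L}^2)$. (Pre-interpolants.) For any formula $B(\overrightarrow{q},\overrightarrow{r})$ and propositional variables $\overrightarrow{q}$ all different from those in $\overrightarrow{r}$, there exists a formula $\mathcal{I}_{pre}(B,\overrightarrow{q})$ such that: (1) $\mathcal{I}_{pre}(B,\overrightarrow{q})\Rightarrow B(\overrightarrow{q},\overrightarrow{r})$ is derivable in $\mathsf{G}(\mathbf{L}^2)$; (2) for any formula $A(\overrightarrow{p},\overrightarrow{q})$, where the variables $\overrightarrow{p}$ differ from those in $\overrightarrow{q}$ and in $\overrightarrow{r}$,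 if $A(\overrightarrow{p},\overrightarrow{q})\Rightarrow B(\overrightarrow{q},\overrightarrow{r})$ is derivable in $\mathsf{G}(\mathbf{L}^2)$, then $A(\overrightarrow{p},\overrightarrow{q})\Rightarrow\mathcal{I}_{pre}(B,\overrightarrow{q})$ is derivable in $\mathsf{G}(\mathbf{L}^2)$.
   Context: Formulas of $\mathcal{L}^2$ over a finite agent set and countable $\mathsf{Prop}$: $A::=p\mid\bot\mid A\wedge A\mid A\vee A\mid A\rightarrow A\mid\neg A\mid\Box_iA\mid\forall pA$; $\exists pA:=\neg\forall p\neg A$. $A(\overrightarrow{p},\overrightarrow{q})$ means the free propositional variables of $A$ are among the finite lists $\overrightarrow{p},\overrightarrow{q}$. $A[p/B]$ is substitution of $B$ for free occurrences of $p$. Outmost-boxed formula: $\Box_jB$; $\Box_i\Gamma=\{\Box_iA:A\in\Gamma\}$. $\mathsf{G}(\mathbf{K_n})$: initial sequents $\Gamma,p\Rightarrow p,\Delta$ and $\bot,\Gamma\Rightarrow\Delta$; logical rules $(R\wedge)$ $\Gamma\Rightarrow\Delta,A_1$ and $\Gamma\Rightarrow\Delta,A_2$ / $\Gamma\Rightarrow\Delta,A_1\wedge A_2$; $(L\wedge)$ $A_1,A_2,\Gamma\Rightarrow\Delta$ / $A_1\wedge A_2,\Gamma\Rightarrow\Delta$; $(R\vee)$ $\Gamma\Rightarrow\Delta,A_1,A_2$ / $\Gamma\Rightarrow\Delta,A_1\vee A_2$; $(L\vee)$ $A_1,\Gamma\Rightarrow\Delta$ and $A_2,\Gamma\Rightarrow\Delta$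 / $A_1\vee A_2,\Gamma\Rightarrow\Delta$; $(R\rightarrow)$ $A_1,\Gamma\Rightarrow\Delta,A_2$ / $\Gamma\Rightarrow\Delta,A_1\rightarrow A_2$; $(L\rightarrow)$ $\Gamma\Rightarrow\Delta,A_1$ and $A_2,\Gamma\Rightarrow\Delta$ / $A_1\rightarrow A_2,\Gamma\Rightarrow\Delta$; $(R\neg)$ $A,\Gamma\Rightarrow\Delta$ / $\Gamma\Rightarrow\Delta,\neg A$; $(L\neg)$ $\Gamma\Rightarrow\Delta,A$ / $\neg A,\Gamma\Rightarrow\Delta$; $(\Box_{Kn})$: from $\Gamma\Rightarrow A$ infer $\Sigma,\Box_i\Gamma\Rightarrow\Box_iA,\Omega$ (members of $\Sigma$: propositional variables, $\bot$, or $\Box_jB$ with $j\neq i$; members of $\Omega$: propositional variables, $\bot$, or outmost-boxed formulas). $\mathsf{G}(\mathbf{KD_n})$ adds $(\Box_{Dn})$: from $\Gamma\Rightarrow$ ($\Gamma\neq\emptyset$) infer $\Sigma,\Box_i\Gamma\Rightarrow\Omega$. $\mathsf{G}(\mathbf{KT_n})$ adds $(\Box_{Tn})$: from $\Box_iA,A,\Gamma\Rightarrow\Delta$ infer $\Box_iA,\Gamma\Rightarrow\Delta$. $\mathsf{G}(\mathbf{L}^2)$ is $\mathsf{G}(\mathbf{L})$ on $\mathcal{L}^2$-formulas plus: initial sequents $\forall p\Box_iA\Rightarrow\Box_i\forall pA$; weakening, contraction and cut (from $\Gamma\Rightarrow\Delta,C$ and $C,\Gamma'\Rightarrow\Delta'$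 infer $\Gamma,\Gamma'\Rightarrow\Delta,\Delta'$) as primitive rules; $(L\forall)$: from $\Gamma,A[p/B]\Rightarrow\Delta$ infer $\Gamma,\forall pA\Rightarrow\Delta$; $(R\forall)$: from $\Gamma\Rightarrow A,\Delta$ infer $\Gamma\Rightarrow\forall pA,\Delta$, provided $p$ is not free in $\Gamma,\Delta$. -}

module Defs where

open import Data.Nat using (ℕ; suc; _≡ᵇ_; _⊔_)
open import Data.Fin using (Fin)
open import Data.Bool using (Bool; true; false; if_then_else_; _∨_)
open import Data.List using (List; []; _∷_; _++_; map; foldr; concatMap)
open import Data.List.Membership.Propositional using (_∉_)
open import Data.List.Relation.Unary.All using (All)
open import Data.List.Relation.Binary.Permutation.Propositional using (_↭_)
open import Relation.Binary.PropositionalEquality using (_≡_; _≢_)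

Prop : Set
Prop = ℕ

data Fm (n : ℕ) : Set where
  var  : Prop → Fm n
  ⊥'   : Fm n
  _∧'_ : Fm n → Fm n → Fm n
  _∨'_ : Fm n → Fm n → Fm n
  _⇒'_ : Fm n → Fm n → Fm n
  ¬'_  : Fm n → Fm n
  □    : Fin n → Fm n → Fm n
  ∀'   : Prop → Fm n → Fm n

∃' : ∀ {n} → Prop → Fm n → Fm n
∃' p A = ¬' ∀' p (¬' A)

remove : Prop → List Prop → List Prop
remove p []       = []
remove p (x ∷ xs) = if x ≡ᵇ p then remove p xs else x ∷ remove p xs

occurs : Prop → List Prop → Bool
occurs p []       = false
occurs p (x ∷ xs) = (x ≡ᵇ p) ∨ occurs p xs

fv : ∀ {n} → Fm n → List Prop
fv (var p)  = p ∷ []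
fv ⊥'       = []
fv (A ∧' B) = fv A ++ fv B
fv (A ∨' B) = fv A ++ fv B
fv (A ⇒' B) = fv A ++ fv B
fv (¬' A)   = fv A
fv (□ i A)  = fv A
fv (∀' p A) = remove p (fv A)

fvs : ∀ {n} → List (Fm n) → List Prop
fvs = concatMap fv

maxList : List ℕ → ℕ
maxList = foldr _⊔_ 0

_[_↦_] : ∀ {n} → (Prop → Fm n) → Prop → Fm n → (Prop → Fm n)
(σ [ p ↦ B ]) r = if r ≡ᵇ p then B else σ r

-- capture-avoiding simultaneous substitution (Curry/Stoughton style):
-- a bound variable is renamed (to a fresh one) only when it would capture.
subst : ∀ {n} → (Prop → Fm n) → Fm n → Fm n
subst σ (var p)  = σ p
subst σ ⊥'       = ⊥'
subst σ (A ∧' B) = subst σ A ∧' subst σ B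
subst σ (A ∨' B) = subst σ A ∨' subst σ B
subst σ (A ⇒' B) = subst σ A ⇒' subst σ B
subst σ (¬' A)   = ¬' subst σ A
subst σ (□ i A)  = □ i (subst σ A)
subst σ (∀' q A) = ∀' q' (subst (σ [ q ↦ var q' ]) A)
  where
  danger : List Prop
  danger = concatMap (λ r → fv (σ r)) (remove q (fv A))
  q' : Prop
  q' = if occurs q danger then suc (maxList (q ∷ danger)) else q

_[_/_] : ∀ {n} → Fm n → Prop → Fm n → Fm n
A [ p / B ] = subst ((var [ p ↦ B ])) A

data SigmaOK {n : ℕ} (i : Fin n) : Fm n → Set where
  s-var : ∀ p → SigmaOK i (var p)
  s-⊥   : SigmaOK i ⊥'
  s-□   : ∀ j B → j ≢ i → SigmaOK i (□ j B)

data OmegaOK {n : ℕ} : Fm n → Set where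
  o-var : ∀ p → OmegaOK (var p)
  o-⊥   : OmegaOK ⊥'
  o-□   : ∀ j B → OmegaOK (□ j B)

data Logic : Set where
  Kn KDn KTn : Logic

-- Derivability in G(L²).  Sequents are pairs of lists read as multisets
-- (the rule `perm` makes the order irrelevant); principal formulas are
-- written at the head of the lists.
data Der {n : ℕ} (L : Logic) : List (Fm n) → List (Fm n) → Set where
  ax    : ∀ Γ Δ p → Der L (var p ∷ Γ) (var p ∷ Δ)
  ax⊥   : ∀ Γ Δ → Der L (⊥' ∷ Γ) Δ
  axBF  : ∀ p i A → Der L (∀' p (□ i A) ∷ []) (□ i (∀' p A) ∷ [])
  perm  : ∀ {Γ Γ' Δ Δ'} → Γ ↭ Γ' → Δ ↭ Δ' → Der L Γ Δ → Der L Γ' Δ'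
  R∧    : ∀ {Γ Δ A₁ A₂} → Der L Γ (A₁ ∷ Δ) → Der L Γ (A₂ ∷ Δ) → Der L Γ (A₁ ∧' A₂ ∷ Δ)
  L∧    : ∀ {Γ Δ A₁ A₂} → Der L (A₁ ∷ A₂ ∷ Γ) Δ → Der L (A₁ ∧' A₂ ∷ Γ) Δ
  R∨    : ∀ {Γ Δ A₁ A₂} → Der L Γ (A₁ ∷ A₂ ∷ Δ) → Der L Γ (A₁ ∨' A₂ ∷ Δ)
  L∨    : ∀ {Γ Δ A₁ A₂} → Der L (A₁ ∷ Γ) Δ → Der L (A₂ ∷ Γ) Δ → Der L (A₁ ∨' A₂ ∷ Γ) Δ
  R⇒    : ∀ {Γ Δ A₁ A₂} → Der L (A₁ ∷ Γ) (A₂ ∷ Δ) → Der L Γ (A₁ ⇒' A₂ ∷ Δ)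
  L⇒    : ∀ {Γ Δ A₁ A₂} → Der L Γ (A₁ ∷ Δ) → Der L (A₂ ∷ Γ) Δ → Der L (A₁ ⇒' A₂ ∷ Γ) Δ
  R¬    : ∀ {Γ Δ A} → Der L (A ∷ Γ) Δ → Der L Γ (¬' A ∷ Δ)
  L¬    : ∀ {Γ Δ A} → Der L Γ (A ∷ Δ) → Der L (¬' A ∷ Γ) Δ
  boxK  : ∀ {Γ A} (i : Fin n) (Σ Ω : List (Fm n)) → All (SigmaOK i) Σ → All OmegaOK Ω →
          Der L Γ (A ∷ []) → Der L (Σ ++ map (□ i) Γ) (□ i A ∷ Ω)
  boxD  : ∀ {Γ} → L ≡ KDn → Γ ≢ [] → (i : Fin n) (Σ Ω : List (Fm n)) →
          All (SigmaOK i) Σ → All OmegaOK Ω →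
          Der L Γ [] → Der L (Σ ++ map (□ i) Γ) Ω
  boxT  : ∀ {Γ Δ} → L ≡ KTn → (i : Fin n) (A : Fm n) →
          Der L (□ i A ∷ A ∷ Γ) Δ → Der L (□ i A ∷ Γ) Δ
  wkL   : ∀ {Γ Δ} A → Der L Γ Δ → Der L (A ∷ Γ) Δ
  wkR   : ∀ {Γ Δ} A → Der L Γ Δ → Der L Γ (A ∷ Δ)
  ctrL  : ∀ {Γ Δ A} → Der L (A ∷ A ∷ Γ) Δ → Der L (A ∷ Γ) Δ
  ctrR  : ∀ {Γ Δ A} → Der L Γ (A ∷ A ∷ Δ) → Der L Γ (A ∷ Δ)
  cut   : ∀ {Γ Δ Γ' Δ' C} → Der L Γ (C ∷ Δ) → Der L (C ∷ Γ') Δ' → Der L (Γ ++ Γ') (Δ ++ Δ')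
  L∀    : ∀ {Γ Δ} p A B → Der L (A [ p / B ] ∷ Γ) Δ → Der L (∀' p A ∷ Γ) Δ
  R∀    : ∀ {Γ Δ} p A → p ∉ fvs Γ → p ∉ fvs Δ → Der L Γ (A ∷ Δ) → Der L Γ (∀' p A ∷ Δ)

_⊢_⇒_ : ∀ {n} → Logic → Fm n → Fm n → Set
L ⊢ A ⇒ B = Der L (A ∷ []) (B ∷ [])

{-# OPTIONS --safe #-}

-- The second-order quantifiers define uniform interpolants outright: ∃ps A is a
-- post-interpolant of A and ∀rs B a pre-interpolant of B.  Instantiating each
-- bound variable by itself gives A ⇒ ∃ps A and ∀rs B ⇒ B.  Conversely, if
-- A ⇒ B then (R∀) turns ⇒ ¬A, B into ⇒ ∀ps ¬A, B, because the eigenvariables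
-- ps do not occur in B; dually for ∀rs B.
module Submission where

open import Defs
open import Data.Nat using (ℕ; _≡ᵇ_)
open import Data.Nat.Properties using (≡ᵇ⇒≡; ≡⇒≡ᵇ)
open import Data.Bool using (true; false; T)
open import Data.Unit using (tt)
open import Data.Empty using (⊥-elim)
open import Data.Sum using (inj₁; inj₂)
open import Data.Product using (Σ-syntax; _×_; _,_)
open import Data.List using (List; []; _∷_; _++_; foldr; concatMap)
open import Data.List.Relation.Unary.Any using (here; there)
open import Data.List.Membership.Propositional using (_∈_; _∉_)
open import Data.List.Membership.Propositional.Properties using (∈-++⁻)
open import Data.List.Relation.Binary.Subset.Propositional using (_⊆_)
open import Data.List.Relation.Binary.Disjoint.Propositional using (Disjoint)
open import Data.List.Relation.Binary.Permutation.Propositional using (swap; ↭-refl)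
open import Data.List.Relation.Unary.All using ([])
open import Relation.Binary.PropositionalEquality
  using (_≡_; _≢_; _≗_; refl; sym; cong; cong₂)
  renaming (subst to transport)

private
  variable
    n : ℕ
    L : Logic
    A B : Fm n
    Γ Δ : List (Fm n)
    x : Prop
    xs ys zs ws : List Prop

≡ᵇ-true⇒≡ : ∀ {m k} → (m ≡ᵇ k) ≡ true → m ≡ k
≡ᵇ-true⇒≡ {m} {k} eq = ≡ᵇ⇒≡ m k (transport T (sym eq) tt)

≡ᵇ-false⇒≢ : ∀ {m k} → (m ≡ᵇ k) ≡ false → m ≢ k
≡ᵇ-false⇒≢ {m} {k} eq m≡k = transport T eq (≡⇒≡ᵇ m k m≡k)

∉-remove : ∀ p xs → p ∉ remove p xs
∉-remove p (y ∷ ys) p∈ with y ≡ᵇ p in eq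
... | true = ∉-remove p ys p∈
∉-remove p (y ∷ ys) (here p≡y)   | false = ≡ᵇ-false⇒≢ eq (sym p≡y)
∉-remove p (y ∷ ys) (there p∈ys) | false = ∉-remove p ys p∈ys

∈-remove⁻ : ∀ p xs → x ∈ remove p xs → x ∈ xs × x ≢ p
∈-remove⁻ p xs x∈ = ∈-remove p xs x∈ , λ { refl → ∉-remove p xs x∈ }
  where
  ∈-remove : ∀ p xs → x ∈ remove p xs → x ∈ xs
  ∈-remove p (y ∷ ys) x∈ with y ≡ᵇ p
  ... | true = there (∈-remove p ys x∈)
  ∈-remove p (y ∷ ys) (here x≡y)   | false = here x≡y
  ∈-remove p (y ∷ ys) (there x∈ys) | false = there (∈-remove p ys x∈ys)

occurs⇒∈ : ∀ p xs → occurs p xs ≡ true → p ∈ xs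
occurs⇒∈ p (y ∷ ys) occ with y ≡ᵇ p in eq
... | true  = here (sym (≡ᵇ-true⇒≡ eq))
... | false = there (occurs⇒∈ p ys occ)

∈-++-∉ˡ : x ∈ xs ++ ys → x ∉ xs → x ∈ ys
∈-++-∉ˡ {xs = xs} x∈ x∉xs with ∈-++⁻ xs x∈
... | inj₁ x∈xs = ⊥-elim (x∉xs x∈xs)
... | inj₂ x∈ys = x∈ys

∈-++-∉ʳ : x ∈ xs ++ ys → x ∉ ys → x ∈ xs
∈-++-∉ʳ {xs = xs} x∈ x∉ys with ∈-++⁻ xs x∈
... | inj₁ x∈xs = x∈xs
... | inj₂ x∈ys = ⊥-elim (x∉ys x∈ys)

Disjoint-⊆-++ : Disjoint xs zs → Disjoint ys zs → ws ⊆ xs ++ ys → Disjoint ws zs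
Disjoint-⊆-++ {xs = xs} xs#zs ys#zs ws⊆ (x∈ws , x∈zs) with ∈-++⁻ xs (ws⊆ x∈ws)
... | inj₁ x∈xs = xs#zs (x∈xs , x∈zs)
... | inj₂ x∈ys = ys#zs (x∈ys , x∈zs)

concatMap-fv-var : (σ : Prop → Fm n) → σ ≗ var → ∀ xs → concatMap (λ r → fv (σ r)) xs ≡ xs
concatMap-fv-var σ σ≗var []       = refl
concatMap-fv-var σ σ≗var (x ∷ xs) rewrite σ≗var x = cong (x ∷_) (concatMap-fv-var σ σ≗var xs)

↦-self-≗-var : (σ : Prop → Fm n) → σ ≗ var → ∀ p → σ [ p ↦ var p ] ≗ var
↦-self-≗-var σ σ≗var p r with r ≡ᵇ p in eq
... | true  = cong var (sym (≡ᵇ-true⇒≡ eq))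
... | false = σ≗var r

-- For σ ≗ var the capture check on ∀q A asks whether q is free in ∀q A, so it never fires.
subst-id : (σ : Prop → Fm n) → σ ≗ var → ∀ A → subst σ A ≡ A
subst-id σ σ≗var (var p)  = σ≗var p
subst-id σ σ≗var ⊥'       = refl
subst-id σ σ≗var (A ∧' B) = cong₂ _∧'_ (subst-id σ σ≗var A) (subst-id σ σ≗var B)
subst-id σ σ≗var (A ∨' B) = cong₂ _∨'_ (subst-id σ σ≗var A) (subst-id σ σ≗var B)
subst-id σ σ≗var (A ⇒' B) = cong₂ _⇒'_ (subst-id σ σ≗var A) (subst-id σ σ≗var B)
subst-id σ σ≗var (¬' A)   = cong ¬'_ (subst-id σ σ≗var A)
subst-id σ σ≗var (□ i A)  = cong (□ i) (subst-id σ σ≗var A)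
subst-id σ σ≗var (∀' q A)
  with occurs q (concatMap (λ r → fv (σ r)) (remove q (fv A))) in captured
... | true  = ⊥-elim (∉-remove q (fv A)
                (transport (q ∈_) (concatMap-fv-var σ σ≗var (remove q (fv A)))
                  (occurs⇒∈ q _ captured)))
... | false = cong (∀' q) (subst-id (σ [ q ↦ var q ]) (↦-self-≗-var σ σ≗var q) A)

[p/p]-identity : ∀ (A : Fm n) p → A [ p / var p ] ≡ A
[p/p]-identity A p = subst-id (var [ p ↦ var p ]) (↦-self-≗-var var (λ _ → refl) p) A

∉-fvs-[_] : ∀ (A : Fm n) → x ∉ fv A → x ∉ fvs (A ∷ [])
∉-fvs-[ A ] x∉A x∈ = x∉A (∈-++-∉ʳ x∈ λ ())

exchangeL : Der L (A ∷ B ∷ Γ) Δ → Der L (B ∷ A ∷ Γ) Δ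
exchangeL = perm (swap _ _ ↭-refl) ↭-refl

exchangeR : Der L Γ (A ∷ B ∷ Δ) → Der L Γ (B ∷ A ∷ Δ)
exchangeR = perm ↭-refl (swap _ _ ↭-refl)

L∀-self : ∀ p → Der L (A ∷ Γ) Δ → Der L (∀' p A ∷ Γ) Δ
L∀-self {L = L} {A = A} {Γ = Γ} {Δ = Δ} p d =
  L∀ p A (var p) (transport (λ A′ → Der L (A′ ∷ Γ) Δ) (sym ([p/p]-identity A p)) d)

⊢-∀-intro : ∀ p → p ∉ fv A → L ⊢ A ⇒ B → L ⊢ A ⇒ ∀' p B
⊢-∀-intro {A = A} {B = B} p p∉A = R∀ p B (∉-fvs-[ A ] p∉A) (λ ())

⊢-∃-intro : ∀ p → L ⊢ A ⇒ B → L ⊢ A ⇒ ∃' p B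
⊢-∃-intro p d = R¬ (L∀-self p (L¬ d))

⊢-∃-elim : ∀ p → p ∉ fv B → L ⊢ A ⇒ B → L ⊢ ∃' p A ⇒ B
⊢-∃-elim {B = B} {A = A} p p∉B d = L¬ (R∀ p (¬' A) (λ ()) (∉-fvs-[ B ] p∉B) (R¬ d))

⊢-refl : ∀ (A : Fm n) → L ⊢ A ⇒ A
⊢-refl (var p)  = ax [] [] p
⊢-refl ⊥'       = ax⊥ [] _
⊢-refl (A ∧' B) = L∧ (R∧ (exchangeL (wkL B (⊢-refl A))) (wkL A (⊢-refl B)))
⊢-refl (A ∨' B) = L∨ (R∨ (exchangeR (wkR B (⊢-refl A)))) (R∨ (wkR A (⊢-refl B)))
⊢-refl (A ⇒' B) =
  R⇒ (exchangeL (L⇒ (exchangeR (wkR B (⊢-refl A))) (exchangeL (wkL A (⊢-refl B)))))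
⊢-refl (¬' A)   = R¬ (exchangeL (L¬ (⊢-refl A)))
⊢-refl (□ i A)  = boxK i [] [] [] [] (⊢-refl A)
⊢-refl (∀' p A) = ⊢-∀-intro p (∉-remove p (fv A)) (L∀-self p (⊢-refl A))

∃* : List Prop → Fm n → Fm n
∃* ps A = foldr ∃' A ps

∀* : List Prop → Fm n → Fm n
∀* rs A = foldr ∀' A rs

⊢-∃*-intro : ∀ ps → L ⊢ A ⇒ B → L ⊢ A ⇒ ∃* ps B
⊢-∃*-intro []       d = d
⊢-∃*-intro (p ∷ ps) d = ⊢-∃-intro p (⊢-∃*-intro ps d)

⊢-∃*-elim : ∀ ps → Disjoint (fv B) ps → L ⊢ A ⇒ B → L ⊢ ∃* ps A ⇒ B
⊢-∃*-elim []       B#ps d = d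
⊢-∃*-elim (p ∷ ps) B#ps d =
  ⊢-∃-elim p (λ p∈B → B#ps (p∈B , here refl))
    (⊢-∃*-elim ps (λ (x∈B , x∈ps) → B#ps (x∈B , there x∈ps)) d)

⊢-∀*-elim : ∀ rs → L ⊢ A ⇒ B → L ⊢ ∀* rs A ⇒ B
⊢-∀*-elim []       d = d
⊢-∀*-elim (r ∷ rs) d = L∀-self r (⊢-∀*-elim rs d)

⊢-∀*-intro : ∀ rs → Disjoint (fv A) rs → L ⊢ A ⇒ B → L ⊢ A ⇒ ∀* rs B
⊢-∀*-intro []       A#rs d = d
⊢-∀*-intro (r ∷ rs) A#rs d =
  ⊢-∀-intro r (λ r∈A → A#rs (r∈A , here refl))
    (⊢-∀*-intro rs (λ (x∈A , x∈rs) → A#rs (x∈A , there x∈rs)) d)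

fv-foldr-binder : (Q : Prop → Fm n → Fm n) → (∀ p A → fv (Q p A) ≡ remove p (fv A)) →
                  ∀ ps → x ∈ fv (foldr Q A ps) → x ∈ fv A × x ∉ ps
fv-foldr-binder Q fv-Q []       x∈ = x∈ , λ ()
fv-foldr-binder {A = A} Q fv-Q (p ∷ ps) x∈
  with ∈-remove⁻ p (fv (foldr Q A ps)) (transport (_ ∈_) (fv-Q p _) x∈)
... | x∈′ , x≢p with fv-foldr-binder Q fv-Q ps x∈′
... | x∈A , x∉ps = x∈A , λ { (here x≡p) → x≢p x≡p ; (there x∈ps) → x∉ps x∈ps }

fv-∃*-⊆ : ∀ ps (A : Fm n) → fv A ⊆ ps ++ xs → fv (∃* ps A) ⊆ xs
fv-∃*-⊆ ps A A⊆ x∈ with fv-foldr-binder ∃' (λ _ _ → refl) ps x∈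
... | x∈A , x∉ps = ∈-++-∉ˡ (A⊆ x∈A) x∉ps

fv-∀*-⊆ : ∀ rs (B : Fm n) → fv B ⊆ xs ++ rs → fv (∀* rs B) ⊆ xs
fv-∀*-⊆ rs B B⊆ x∈ with fv-foldr-binder ∀' (λ _ _ → refl) rs x∈
... | x∈B , x∉rs = ∈-++-∉ʳ (B⊆ x∈B) x∉rs

lemma5p8 : (L : Logic) (n : ℕ) →
    -- post-interpolants
    ((A : Fm n) (ps qs : List Prop) → fv A ⊆ ps ++ qs → Disjoint qs ps →
      Σ[ I ∈ Fm n ] (fv I ⊆ qs × L ⊢ A ⇒ I ×
        ((B : Fm n) (rs : List Prop) → fv B ⊆ qs ++ rs → Disjoint rs qs → Disjoint rs ps →
          L ⊢ A ⇒ B → L ⊢ I ⇒ B)))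
    ×
    -- pre-interpolants
    ((B : Fm n) (qs rs : List Prop) → fv B ⊆ qs ++ rs → Disjoint qs rs →
      Σ[ I ∈ Fm n ] (fv I ⊆ qs × L ⊢ I ⇒ B ×
        ((A : Fm n) (ps : List Prop) → fv A ⊆ ps ++ qs → Disjoint ps qs → Disjoint ps rs →
          L ⊢ A ⇒ B → L ⊢ A ⇒ I)))
lemma5p8 L n =
  (λ A ps qs A⊆ qs#ps →
     ∃* ps A , fv-∃*-⊆ ps A A⊆ , ⊢-∃*-intro ps (⊢-refl A) ,
     λ B rs B⊆ _ rs#ps → ⊢-∃*-elim ps (Disjoint-⊆-++ qs#ps rs#ps B⊆))
  ,
  (λ B qs rs B⊆ qs#rs →
     ∀* rs B , fv-∀*-⊆ rs B B⊆ , ⊢-∀*-elim rs (⊢-refl B) ,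
     λ A ps A⊆ _ ps#rs → ⊢-∀*-intro rs (Disjoint-⊆-++ ps#rs qs#rs A⊆))
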